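{- Let $\mathcal{G} = (G_1, \dots, G_T)$ be a temporal graph on vertex set $V = \{v_1, \dots, v_n\}$ all of whose snapshots are bipartite, and let $(A, B)$ be a partition of the vertex set of the auxiliary graph $\alpha(\mathcal{G})$ such that at most $c$ edges of $\alpha(\mathcal{G})$ have both endpoints in the same class. Then there exists a temporal sequence $2$-colouring $\Psi$ of $\mathcal{G}$ with $\mathrm{Cost}(\Psi) \leq 2c$.
   Context: A temporal graph $(G_1, \dots, G_T)$ is a sequence of static graphs $G_t = (V, E_t)$ on a common vertex set. A temporal sequence $2$-colouring is a sequence $\psi_1, \dots, \psi_T$ where $\psi_t : V \to \{0,1\}$ is a proper colouring of $G_t$; its cost $\mathrm{Cost}(\Psi)$ is the number of pairs $(v, t)$, $1 \le t \le T-1$, with $\psi_t(v) \neq \psi_{t+1}(v)$. The auxiliary static graph $\alpha(\mathcal{G})$ has vertex set $\{v_{i,t} : i \in \{1,\dots,n\}, t \in \{1,\dots,T\}\}$ and edge set $C \cup S$, where $C = \{v_{i,t} v_{i,t+1} : i \in \{1,\dots,n\}, t \in \{1,\dots,T-1\}\}$ and $S$ is obtained as follows: for each $t$ and each connected component $K$ of $G_t$, take a proper $2$-colouring $\psi$ of $K$, and add the edge $v_{i,t} v_{j,t}$ for every pair of vertices $v_i, v_j$ of $K$ with $\psi(v_i) \neq \psi(v_j)$. -}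

module Defs where

open import Data.Nat using (ℕ; zero; suc; _+_; _≡ᵇ_; _<ᵇ_)
open import Data.Fin using (Fin; toℕ) renaming (zero to fzero; suc to fsuc)
import Data.Fin as Fin
open import Data.Bool using (Bool; true; false; if_then_else_; _∧_; _∨_; not; _xor_)
open import Data.Product using (Σ; proj₁)
open import Relation.Binary.PropositionalEquality using (_≡_; _≢_)
open import Relation.Nullary.Decidable using (⌊_⌋)

-- A (simple, undirected) graph on vertex set {v_1..v_n} = Fin n, given by
-- its adjacency relation (symmetry is imposed as a hypothesis in the statement).
Graph : ℕ → Set
Graph n = Fin n → Fin n → Bool

TemporalGraph : ℕ → ℕ → Set
TemporalGraph n T = Fin T → Graph n

Symmetric : ∀ {n} → Graph n → Set
Symmetric {n} G = ∀ (i j : Fin n) → G i j ≡ G j i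

Proper : ∀ {n} → Graph n → (Fin n → Bool) → Set
Proper {n} G ψ = ∀ (i j : Fin n) → G i j ≡ true → ψ i ≢ ψ j

Bipartite : ∀ {n} → Graph n → Set
Bipartite {n} G = Σ (Fin n → Bool) (λ ψ → Proper G ψ)

anyFin : ∀ {k} → (Fin k → Bool) → Bool
anyFin {zero} f = false
anyFin {suc k} f = f fzero ∨ anyFin (λ x → f (fsuc x))

countFin : ∀ {k} → (Fin k → Bool) → ℕ
countFin {zero} f = 0
countFin {suc k} f = (if f fzero then 1 else 0) + countFin (λ x → f (fsuc x))

_==F_ : ∀ {n} → Fin n → Fin n → Bool
i ==F j = ⌊ i Fin.≟ j ⌋

reachWithin : ∀ {n} → Graph n → ℕ → Fin n → Fin n → Bool
reachWithin G zero i j = i ==F j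
reachWithin G (suc k) i j =
  reachWithin G k i j ∨ anyFin (λ m → reachWithin G k i m ∧ G m j)

-- i and j lie in the same connected component of G
-- (equivalently: joined by a walk of length at most n).
sameComponent : ∀ {n} → Graph n → Fin n → Fin n → Bool
sameComponent {n} G i j = reachWithin G n i j

-- Number of edges of the auxiliary graph α(G) with both endpoints in the same
-- class of the partition (A, B), where the partition of the vertices v_{i,t}
-- of α(G) is given by A : Fin n → Fin T → Bool (true = class A, false = class B).
-- The vertex v_{i,t} corresponds to the pair (i, t).
-- The colouring of each component K of G_t used in the definition of S is the
-- restriction to K of the proper colouring supplied by the bipartiteness witness.

sumFin : ∀ {k} → (Fin k → ℕ) → ℕ
sumFin {zero} f = 0
sumFin {suc k} f = f fzero + sumFin (λ x → f (fsuc x))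

-- Monochromatic edges of C: v_{i,s} v_{i,t} with t = s + 1.
monoC : ∀ {n T} → (Fin n → Fin T → Bool) → ℕ
monoC {n} {T} A =
  sumFin (λ (i : Fin n) → sumFin (λ (s : Fin T) → countFin (λ (t : Fin T) →
    (toℕ t ≡ᵇ suc (toℕ s)) ∧ not (A i s xor A i t))))

-- Monochromatic edges of S: for each t, unordered pairs {i, j} (counted once,
-- via toℕ i < toℕ j) in the same component of G_t with different colours.
monoS : ∀ {n T} → (G : TemporalGraph n T) → (∀ t → Bipartite (G t)) →
        (Fin n → Fin T → Bool) → ℕ
monoS {n} {T} G bip A =
  sumFin (λ (t : Fin T) → sumFin (λ (i : Fin n) → countFin (λ (j : Fin n) →
    (toℕ i <ᵇ toℕ j) ∧ sameComponent (G t) i j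
      ∧ (proj₁ (bip t) i xor proj₁ (bip t) j)
      ∧ not (A i t xor A j t))))

monoEdges : ∀ {n T} → (G : TemporalGraph n T) → (∀ t → Bipartite (G t)) →
            (Fin n → Fin T → Bool) → ℕ
monoEdges G bip A = monoC A + monoS G bip A

IsTemporalColouring : ∀ {n T} → TemporalGraph n T → (Fin T → Fin n → Bool) → Set
IsTemporalColouring {n} {T} G Ψ = ∀ (t : Fin T) → Proper (G t) (Ψ t)

Cost : ∀ {n T} → (Fin T → Fin n → Bool) → ℕ
Cost {n} {T} Ψ =
  sumFin (λ (v : Fin n) → sumFin (λ (s : Fin T) → countFin (λ (t : Fin T) →
    (toℕ t ≡ᵇ suc (toℕ s)) ∧ (Ψ s v xor Ψ t v))))

{-# OPTIONS --safe #-}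
-- In each snapshot G_t, recolour every connected component by φ_t or by its complement,
-- whichever disagrees with the side A(·, t) on fewer vertices. If a component has x₁, x₀
-- vertices of φ-colour true on sides A, B and y₁, y₀ of colour false, the two choices disagree
-- on x₀ + y₁ and x₁ + y₀ vertices, while it contains x₁ y₁ + x₀ y₀ monochromatic S-edges; as a
-- component with two or more vertices has both colours, the smaller count is at most that.
-- So the total disagreement D is at most the number of monochromatic S-edges.
-- The C-edges join consecutive times, so shift the recoloured ψ_t by the parity of t: a vertex
-- changes colour between t and t + 1 only if ψ disagrees with A at t or at t + 1, or its C-edge
-- is monochromatic. Hence the cost is at most 2 D + #(monochromatic C-edges) ≤ 2 c.
module Submission where

open import Defs
open import Data.Nat using (ℕ; _≤_; _*_)
open import Data.Fin using (Fin)
open import Data.Bool using (Bool)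
open import Data.Product using (Σ; _×_)

open import Data.Bool using (true; false; not; _∧_; _∨_; _xor_; if_then_else_; T)
open import Data.Bool.Properties
  using ( T-≡; ⇔→≡; ∧-conicalˡ; ∧-conicalʳ; ∧-assoc; ∧-identityʳ; ∨-zeroʳ; not-involutive
        ; not-injective; ¬-not; not-distribˡ-xor; not-distribʳ-xor; xor-same; xor-comm )
open import Data.Empty using (⊥)
open import Data.Fin using (zero; suc; toℕ; _≟_)
open import Data.Fin.Properties using (toℕ-injective) renaming (suc-injective to Fin-suc-injective)
import Data.Maybe as Maybe
open Maybe using (Maybe; just; nothing; fromMaybe)
open import Data.Nat using (zero; suc; _+_; _<_; _⊓_; _≡ᵇ_; _<ᵇ_; _≤ᵇ_; z≤n; s≤s)
open import Data.Nat.Properties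
  using ( ≤-refl; ≤-reflexive; ≤-trans; +-mono-≤; +-monoˡ-≤; *-monoʳ-≤; *-cancelˡ-≤; +-comm
        ; +-assoc; +-identityʳ; +-suc; m≤m+n; m≤n+m; m≤m*n; m≤n*m; m⊓n≤m; m⊓n≤n; ⊓-comm
        ; m≤n⇒m⊓n≡m; m≥n⇒m⊓n≡n; ≰⇒≥; n≮n; <-cmp; ≡ᵇ⇒≡; <⇒<ᵇ; ≤ᵇ⇒≤; ≤⇒≤ᵇ; suc-injective
        ; +-0-commutativeMonoid; +-*-semiring; module ≤-Reasoning )
open import Data.Nat.Tactic.RingSolver using (solve-∀)
open import Algebra.Properties.CommutativeMonoid.Sum +-0-commutativeMonoid
  using (sum; sum-cong-≗; ∑-distrib-+; ∑-comm)
open import Algebra.Properties.Semiring.Sum +-*-semiring using (*-distribˡ-sum)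
open import Data.Product using (_,_; proj₁; proj₂; ∃; ∃₂)
import Data.Product as Product
open import Data.Sum using (_⊎_; inj₁; inj₂)
open import Function using (_∘_; Equivalence; mk⇔)
open import Relation.Binary.Definitions using (tri<; tri≈; tri>)
open import Relation.Binary.PropositionalEquality
  using (_≡_; _≢_; refl; sym; trans; cong; cong₂; subst; module ≡-Reasoning)
open import Relation.Nullary using (yes; no; contradiction)
open import Relation.Nullary.Decidable using (toWitness; fromWitness; ⌊⌋-map′)

χ : Bool → ℕ
χ b = if b then 1 else 0

-- (b is p) ≡ true exactly when b ≡ p; written so that b is true and b is false
-- reduce to b and not b.
_is_ : Bool → Bool → Bool
b is p = not p xor b

is-sound : ∀ {b} p → (b is p) ≡ true → b ≡ p
is-sound {true}  true  _ = refl
is-sound {false} false _ = refl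
is-sound {true}  false ()
is-sound {false} true  ()

is-not : ∀ b p → (b is p) ≢ true → b ≡ not p
is-not true  true  b≢p = contradiction refl b≢p
is-not true  false _   = refl
is-not false true  _   = refl
is-not false false b≢p = contradiction refl b≢p

T⇒≡ : ∀ {b} → T b → b ≡ true
T⇒≡ = Equivalence.to T-≡

≡⇒T : ∀ {b} → b ≡ true → T b
≡⇒T = Equivalence.from T-≡

∨-introˡ : ∀ {a} b → a ≡ true → (a ∨ b) ≡ true
∨-introˡ _ refl = refl

∨-introʳ : ∀ a {b} → b ≡ true → (a ∨ b) ≡ true
∨-introʳ a refl = ∨-zeroʳ a

∨-elim : ∀ {a b} → (a ∨ b) ≡ true → a ≡ true ⊎ b ≡ true
∨-elim {true}  _ = inj₁ refl
∨-elim {false} e = inj₂ e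

∧-intro : ∀ {a b} → a ≡ true → b ≡ true → (a ∧ b) ≡ true
∧-intro refl refl = refl

xor-cancelˡ : ∀ b {x y} → b xor x ≡ b xor y → x ≡ y
xor-cancelˡ true    = not-injective
xor-cancelˡ false e = e

xor-alternate : ∀ π x y → (π xor x) xor (not π xor y) ≡ not (x xor y)
xor-alternate true  x y = sym (not-distribˡ-xor x y)
xor-alternate false x y = sym (not-distribʳ-xor x y)

unchanged-charge : ∀ x y u w → not (x xor y) ≡ true → ((x xor u) ∨ not (u xor w) ∨ (y xor w)) ≡ true
unchanged-charge true  true  false _     _ = refl
unchanged-charge true  true  true  true  _ = refl
unchanged-charge true  true  true  false _ = refl
unchanged-charge false false true  _     _ = refl
unchanged-charge false false false true  _ = refl
unchanged-charge false false false false _ = refl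
unchanged-charge true  false _     _     ()
unchanged-charge false true  _     _     ()

==F⇒≡ : ∀ {n} {i j : Fin n} → (i ==F j) ≡ true → i ≡ j
==F⇒≡ e = toWitness (≡⇒T e)

≡⇒==F : ∀ {n} {i j : Fin n} → i ≡ j → (i ==F j) ≡ true
≡⇒==F e = T⇒≡ (fromWitness e)

-- Finite sums and counts

sumFin≡sum : ∀ {k} (f : Fin k → ℕ) → sumFin f ≡ sum f
sumFin≡sum {zero}  f = refl
sumFin≡sum {suc k} f = cong (f zero +_) (sumFin≡sum (λ x → f (suc x)))

sumFin-zero : ∀ {k} → sumFin {k} (λ _ → 0) ≡ 0
sumFin-zero {zero}  = refl
sumFin-zero {suc k} = sumFin-zero {k}

sumFin-cong : ∀ {k} {f g : Fin k → ℕ} → (∀ x → f x ≡ g x) → sumFin f ≡ sumFin g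
sumFin-cong {zero}  _ = refl
sumFin-cong {suc k} e = cong₂ _+_ (e zero) (sumFin-cong (λ x → e (suc x)))

sumFin-mono : ∀ {k} {f g : Fin k → ℕ} → (∀ x → f x ≤ g x) → sumFin f ≤ sumFin g
sumFin-mono {zero}  _  = z≤n
sumFin-mono {suc k} le = +-mono-≤ (le zero) (sumFin-mono (λ x → le (suc x)))

sumFin-+ : ∀ {k} (f g : Fin k → ℕ) → sumFin (λ x → f x + g x) ≡ sumFin f + sumFin g
sumFin-+ f g = begin
  sumFin (λ x → f x + g x) ≡⟨ sumFin≡sum (λ x → f x + g x) ⟩
  sum (λ x → f x + g x)    ≡⟨ ∑-distrib-+ f g ⟩
  sum f + sum g            ≡⟨ cong₂ _+_ (sumFin≡sum f) (sumFin≡sum g) ⟨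
  sumFin f + sumFin g      ∎
  where open ≡-Reasoning

sumFin-+₃ : ∀ {k} (f g h : Fin k → ℕ) →
            sumFin (λ x → f x + g x + h x) ≡ sumFin f + sumFin g + sumFin h
sumFin-+₃ f g h = trans (sumFin-+ (λ x → f x + g x) h) (cong (_+ sumFin h) (sumFin-+ f g))

sumFin-*ˡ : ∀ {k} c (f : Fin k → ℕ) → c * sumFin f ≡ sumFin (λ x → c * f x)
sumFin-*ˡ c f = begin
  c * sumFin f           ≡⟨ cong (c *_) (sumFin≡sum f) ⟩
  c * sum f              ≡⟨ *-distribˡ-sum c f ⟩
  sum (λ x → c * f x)    ≡⟨ sumFin≡sum (λ x → c * f x) ⟨
  sumFin (λ x → c * f x) ∎
  where open ≡-Reasoning

sumFin-swap : ∀ {k l} (f : Fin k → Fin l → ℕ) →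
              sumFin (λ i → sumFin (f i)) ≡ sumFin (λ j → sumFin (λ i → f i j))
sumFin-swap f = begin
  sumFin (λ i → sumFin (f i))         ≡⟨ sumFin²≡sum² f ⟩
  sum (λ i → sum (f i))               ≡⟨ ∑-comm f ⟩
  sum (λ j → sum (λ i → f i j))       ≡⟨ sumFin²≡sum² (λ j i → f i j) ⟨
  sumFin (λ j → sumFin (λ i → f i j)) ∎
  where
  open ≡-Reasoning
  sumFin²≡sum² : ∀ {k l} (g : Fin k → Fin l → ℕ) → sumFin (λ i → sumFin (g i)) ≡ sum (λ i → sum (g i))
  sumFin²≡sum² g = trans (sumFin≡sum (λ i → sumFin (g i))) (sum-cong-≗ (λ i → sumFin≡sum (g i)))

-- suc r ==F suc k is not definitionally r ==F k, hence ⌊⌋-map′.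
sumFin-delta : ∀ {m} (k : Fin m) x → sumFin (λ r → if r ==F k then x else 0) ≡ x
sumFin-delta {suc m} zero x = trans (cong (x +_) (sumFin-zero {m})) (+-identityʳ x)
sumFin-delta (suc k) x =
  trans (sumFin-cong (λ r → cong (λ b → if b then x else 0) (⌊⌋-map′ _ _ (r ≟ k)))) (sumFin-delta k x)

sumFin-fibres : ∀ {k m} (κ : Fin k → Fin m) (h : Fin k → ℕ) →
                sumFin h ≡ sumFin (λ r → sumFin (λ j → if r ==F κ j then h j else 0))
sumFin-fibres κ h = begin
  sumFin h                                ≡⟨ sumFin-cong (λ j → sumFin-delta (κ j) (h j)) ⟨
  sumFin (λ j → sumFin (λ r → fibre r j)) ≡⟨ sumFin-swap (λ j r → fibre r j) ⟩
  sumFin (λ r → sumFin (fibre r))         ∎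
  where
  open ≡-Reasoning
  fibre = λ r j → if r ==F κ j then h j else 0

sumFin-if-split : ∀ {k} (P c : Fin k → Bool) (h : Fin k → ℕ) →
  sumFin (λ j → if P j then h j else 0)
    ≡ sumFin (λ j → if P j ∧ c j then h j else 0) + sumFin (λ j → if P j ∧ not (c j) then h j else 0)
sumFin-if-split {k} P c h = trans (sumFin-cong split) (sumFin-+ inside outside)
  where
  inside outside : Fin k → ℕ
  inside  j = if P j ∧ c j then h j else 0
  outside j = if P j ∧ not (c j) then h j else 0
  split : ∀ j → (if P j then h j else 0) ≡ inside j + outside j
  split j with P j | c j
  ... | true  | true  = sym (+-identityʳ (h j))
  ... | true  | false = refl
  ... | false | _     = refl

sumFin-if-const : ∀ {k} (P : Fin k → Bool) {h : Fin k → ℕ} {x} → (∀ {j} → P j ≡ true → h j ≡ x) →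
                  sumFin (λ j → if P j then h j else 0) ≡ countFin P * x
sumFin-if-const {zero}  P _ = refl
sumFin-if-const {suc k} P const with P zero in P₀
... | true  = cong₂ _+_ (const P₀) (sumFin-if-const (λ j → P (suc j)) const)
... | false = sumFin-if-const (λ j → P (suc j)) const

typeCount : ∀ {k} → (P f g : Fin k → Bool) → Bool → Bool → ℕ
typeCount P f g p q = countFin (λ j → (P j ∧ (f j is p)) ∧ (g j is q))

sumFin-if-byType : ∀ {k} (P f g : Fin k → Bool) (h : Bool → Bool → ℕ) →
  let N = typeCount P f g in
  sumFin (λ j → if P j then h (f j) (g j) else 0)
    ≡ N true true * h true true + N true false * h true false
      + N false true * h false true + N false false * h false false
sumFin-if-byType {k} P f g h = begin
    S P
  ≡⟨ sumFin-if-split P f H ⟩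
    S (λ j → P j ∧ f j) + S (λ j → P j ∧ not (f j))
  ≡⟨ cong₂ _+_ (sumFin-if-split (λ j → P j ∧ f j) g H) (sumFin-if-split (λ j → P j ∧ not (f j)) g H) ⟩
    (S (type true true) + S (type true false)) + (S (type false true) + S (type false false))
  ≡⟨ cong₂ _+_ (cong₂ _+_ (piece true true) (piece true false))
               (cong₂ _+_ (piece false true) (piece false false)) ⟩
    (N true true * h true true + N true false * h true false)
      + (N false true * h false true + N false false * h false false)
  ≡⟨ +-assoc (N true true * h true true + N true false * h true false) _ _ ⟨
    N true true * h true true + N true false * h true false
      + N false true * h false true + N false false * h false false ∎
  where
  open ≡-Reasoning
  N = typeCount P f g
  H : Fin k → ℕ
  H j = h (f j) (g j)
  S : (Fin k → Bool) → ℕ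
  S Q = sumFin (λ j → if Q j then H j else 0)
  type : Bool → Bool → Fin k → Bool
  type p q j = (P j ∧ (f j is p)) ∧ (g j is q)
  piece : ∀ p q → S (type p q) ≡ N p q * h p q
  piece p q = sumFin-if-const (type p q) {H} λ {j} e →
    cong₂ h (is-sound p (∧-conicalʳ (P j) _ (∧-conicalˡ (P j ∧ (f j is p)) _ e)))
            (is-sound q (∧-conicalʳ (P j ∧ (f j is p)) _ e))

countFin≡sumFin : ∀ {k} (p : Fin k → Bool) → countFin p ≡ sumFin (λ x → χ (p x))
countFin≡sumFin {zero}  p = refl
countFin≡sumFin {suc k} p = cong (χ (p zero) +_) (countFin≡sumFin (λ x → p (suc x)))

countFin-cong : ∀ {k} {p q : Fin k → Bool} → (∀ x → p x ≡ q x) → countFin p ≡ countFin q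
countFin-cong {zero}  _ = refl
countFin-cong {suc k} e = cong₂ _+_ (cong χ (e zero)) (countFin-cong (λ x → e (suc x)))

countFin-split : ∀ {k} (p c : Fin k → Bool) →
                 countFin p ≡ countFin (λ j → p j ∧ c j) + countFin (λ j → p j ∧ not (c j))
countFin-split p c = begin
    countFin p
  ≡⟨ countFin≡sumFin p ⟩
    sumFin (λ j → χ (p j))
  ≡⟨ sumFin-if-split p c (λ _ → 1) ⟩
    sumFin (λ j → χ (p j ∧ c j)) + sumFin (λ j → χ (p j ∧ not (c j)))
  ≡⟨ cong₂ _+_ (countFin≡sumFin (λ j → p j ∧ c j)) (countFin≡sumFin (λ j → p j ∧ not (c j))) ⟨
    countFin (λ j → p j ∧ c j) + countFin (λ j → p j ∧ not (c j)) ∎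
  where open ≡-Reasoning

countFin-swap : ∀ {k l} (p : Fin k → Fin l → Bool) →
                sumFin (λ i → countFin (p i)) ≡ sumFin (λ j → countFin (λ i → p i j))
countFin-swap p = begin
  sumFin (λ i → countFin (p i))           ≡⟨ sumFin-cong (λ i → countFin≡sumFin (p i)) ⟩
  sumFin (λ i → sumFin (λ j → χ (p i j))) ≡⟨ sumFin-swap (λ i j → χ (p i j)) ⟩
  sumFin (λ j → sumFin (λ i → χ (p i j))) ≡⟨ sumFin-cong (λ j → countFin≡sumFin (λ i → p i j)) ⟨
  sumFin (λ j → countFin (λ i → p i j))   ∎
  where open ≡-Reasoning

_⊆_ : ∀ {k} → (Fin k → Bool) → (Fin k → Bool) → Set
p ⊆ q = ∀ {x} → p x ≡ true → q x ≡ true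

countFin-mono : ∀ {k} {p q : Fin k → Bool} → p ⊆ q → countFin p ≤ countFin q
countFin-mono {zero}  _   = z≤n
countFin-mono {suc k} {p} {q} p⊆q =
  +-mono-≤ (χ-mono p⊆q) (countFin-mono {p = λ x → p (suc x)} {q = λ x → q (suc x)} p⊆q)
  where
  χ-mono : ∀ {b c} → (b ≡ true → c ≡ true) → χ b ≤ χ c
  χ-mono {false} _ = z≤n
  χ-mono {true}  h rewrite h refl = ≤-refl

countFin-∨ : ∀ {k} (p q : Fin k → Bool) → countFin (λ x → p x ∨ q x) ≤ countFin p + countFin q
countFin-∨ p q = begin
  countFin (λ x → p x ∨ q x)        ≡⟨ countFin≡sumFin (λ x → p x ∨ q x) ⟩
  sumFin (λ x → χ (p x ∨ q x))      ≤⟨ sumFin-mono (λ x → χ-∨ (p x) (q x)) ⟩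
  sumFin (λ x → χ (p x) + χ (q x))  ≡⟨ sumFin-+ (χ ∘ p) (χ ∘ q) ⟩
  sumFin (χ ∘ p) + sumFin (χ ∘ q)   ≡⟨ cong₂ _+_ (countFin≡sumFin p) (countFin≡sumFin q) ⟨
  countFin p + countFin q           ∎
  where
  open ≤-Reasoning
  χ-∨ : ∀ b c → χ (b ∨ c) ≤ χ b + χ c
  χ-∨ true  _ = s≤s z≤n
  χ-∨ false _ = ≤-refl

countFin-∨₃ : ∀ {k} {p q r s : Fin k → Bool} → p ⊆ (λ x → q x ∨ r x ∨ s x) →
              countFin p ≤ countFin q + countFin r + countFin s
countFin-∨₃ {p = p} {q} {r} {s} p⊆ = begin
  countFin p                               ≤⟨ countFin-mono {q = λ x → q x ∨ r x ∨ s x} p⊆ ⟩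
  countFin (λ x → q x ∨ r x ∨ s x)         ≤⟨ countFin-∨ q (λ x → r x ∨ s x) ⟩
  countFin q + countFin (λ x → r x ∨ s x)  ≤⟨ +-mono-≤ ≤-refl (countFin-∨ r s) ⟩
  countFin q + (countFin r + countFin s)   ≡⟨ +-assoc (countFin q) (countFin r) (countFin s) ⟨
  countFin q + countFin r + countFin s     ∎
  where open ≤-Reasoning

countFin-≤ : ∀ {k} (p : Fin k → Bool) → countFin p ≤ k
countFin-≤ {zero}  p = z≤n
countFin-≤ {suc k} p = +-mono-≤ (χ≤1 (p zero)) (countFin-≤ (λ x → p (suc x)))
  where
  χ≤1 : ∀ b → χ b ≤ 1
  χ≤1 true  = ≤-refl
  χ≤1 false = z≤n

countFin-witness : ∀ {k} (p : Fin k → Bool) {x} → p x ≡ true → 1 ≤ countFin p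
countFin-witness p {zero}  e rewrite e = s≤s z≤n
countFin-witness p {suc x} e = ≤-trans (countFin-witness (λ y → p (suc y)) e) (m≤n+m _ (χ (p zero)))

countFin≡0⇒false : ∀ {k} (p : Fin k → Bool) → countFin p ≡ 0 → ∀ {x} → p x ≢ true
countFin≡0⇒false p none px = contradiction (subst (1 ≤_) none (countFin-witness p px)) λ ()

countFin-none : ∀ {k} (p : Fin k → Bool) → (∀ {x} → p x ≢ true) → countFin p ≡ 0
countFin-none {zero}  p _    = refl
countFin-none {suc k} p none rewrite ¬-not (none {zero}) = countFin-none (λ x → p (suc x)) none

countFin-≤1 : ∀ {k} (p : Fin k → Bool) → (∀ {x y} → p x ≡ true → p y ≡ true → x ≡ y) → countFin p ≤ 1
countFin-≤1 {zero}  p _ = z≤n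
countFin-≤1 {suc k} p unique with p zero in p₀
... | true  = s≤s (≤-reflexive (countFin-none (λ x → p (suc x)) λ px → contradiction (unique p₀ px) λ ()))
... | false = countFin-≤1 (λ x → p (suc x)) λ px py → Fin-suc-injective (unique px py)

countFin-guard : ∀ {k} b (p : Fin k → Bool) → countFin p ≤ 1 → countFin (λ x → b ∧ p x) ≤ χ b
countFin-guard     true  p le = le
countFin-guard {k} false p _  = ≤-reflexive (countFin-none {k} (λ _ → false) λ ())

countFin-⊂ : ∀ {k} (p q : Fin k → Bool) → p ⊆ q → q ⊆ p ⊎ countFin p < countFin q
countFin-⊂ {zero}  p q _ = inj₁ λ { {()} }
countFin-⊂ {suc k} p q p⊆q
  with p zero in p₀ | q zero in q₀ | countFin-⊂ (λ x → p (suc x)) (λ x → q (suc x)) p⊆q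
... | true  | false | _ = contradiction (trans (sym (p⊆q p₀)) q₀) λ ()
... | false | true  | _ = inj₂ (s≤s (countFin-mono {p = λ x → p (suc x)} {q = λ x → q (suc x)} p⊆q))
... | true  | true  | inj₁ q⊆p = inj₁ λ { {zero} _ → p₀ ; {suc x} → q⊆p }
... | false | false | inj₁ q⊆p = inj₁ λ { {zero} q₀′ → contradiction (trans (sym q₀) q₀′) λ ()
                                       ; {suc x} → q⊆p }
... | true  | true  | inj₂ lt = inj₂ (s≤s lt)
... | false | false | inj₂ lt = inj₂ lt

-- Connected components of a snapshot

anyFin-intro : ∀ {k} (f : Fin k → Bool) {x} → f x ≡ true → anyFin f ≡ true
anyFin-intro f {zero}  e = ∨-introˡ _ e
anyFin-intro f {suc x} e = ∨-introʳ (f zero) (anyFin-intro (λ y → f (suc y)) e)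

anyFin-elim : ∀ {k} (f : Fin k → Bool) → anyFin f ≡ true → ∃ λ x → f x ≡ true
anyFin-elim {suc k} f e with ∨-elim {f zero} e
... | inj₁ e₀ = zero , e₀
... | inj₂ e′ = Product.map suc (λ fx → fx) (anyFin-elim (λ y → f (suc y)) e′)

firstTrue : ∀ {k} → (Fin k → Bool) → Maybe (Fin k)
firstTrue {zero}  f = nothing
firstTrue {suc k} f = if f zero then just zero else Maybe.map suc (firstTrue (λ x → f (suc x)))

firstTrue-cong : ∀ {k} {f g : Fin k → Bool} → (∀ x → f x ≡ g x) → firstTrue f ≡ firstTrue g
firstTrue-cong {zero}  _ = refl
firstTrue-cong {suc k} e =
  cong₂ (λ b r → if b then just zero else Maybe.map suc r) (e zero) (firstTrue-cong (λ x → e (suc x)))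

firstTrue-sound : ∀ {k} (f : Fin k → Bool) {x} → firstTrue f ≡ just x → f x ≡ true
firstTrue-sound {suc k} f e with f zero in f₀ | firstTrue (λ x → f (suc x)) in e′
firstTrue-sound {suc k} f refl | true  | _      = f₀
firstTrue-sound {suc k} f refl | false | just y = firstTrue-sound (λ x → f (suc x)) e′

firstTrue-complete : ∀ {k} (f : Fin k → Bool) {x} → f x ≡ true → ∃ λ y → firstTrue f ≡ just y
firstTrue-complete {suc k} f {zero}  fx rewrite fx = zero , refl
firstTrue-complete {suc k} f {suc x} fx with f zero
... | true  = zero , refl
... | false = Product.map suc (cong (Maybe.map suc)) (firstTrue-complete (λ y → f (suc y)) fx)

module Reachability {n} (G : Graph n) where

  Closed : (Fin n → Bool) → Set
  Closed S = ∀ {m j} → S m ≡ true → G m j ≡ true → S j ≡ true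

  reach-refl : ∀ k i → reachWithin G k i i ≡ true
  reach-refl zero    i = ≡⇒==F refl
  reach-refl (suc k) i = ∨-introˡ _ (reach-refl k i)

  reach-step : ∀ k i {m j} → reachWithin G k i m ≡ true → G m j ≡ true →
               reachWithin G (suc k) i j ≡ true
  reach-step k i {m} {j} r g =
    ∨-introʳ (reachWithin G k i j) (anyFin-intro (λ m → reachWithin G k i m ∧ G m j) (∧-intro r g))

  reach-last : ∀ k i j → reachWithin G (suc k) i j ≡ true →
               reachWithin G k i j ≡ true ⊎ ∃ λ m → reachWithin G k i m ≡ true × G m j ≡ true
  reach-last k i j r with ∨-elim {reachWithin G k i j} r
  ... | inj₁ r′ = inj₁ r′
  ... | inj₂ e  =
    let m , rg = anyFin-elim (λ m → reachWithin G k i m ∧ G m j) e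
    in inj₂ (m , ∧-conicalˡ (reachWithin G k i m) (G m j) rg , ∧-conicalʳ (reachWithin G k i m) (G m j) rg)

  reach-closed : ∀ {S} → Closed S → ∀ {i} → S i ≡ true → ∀ k j → reachWithin G k i j ≡ true → S j ≡ true
  reach-closed {S} _ Si zero j r = subst (λ x → S x ≡ true) (==F⇒≡ r) Si
  reach-closed closed {i} Si (suc k) j r with reach-last k i j r
  ... | inj₁ r′           = reach-closed closed Si k j r′
  ... | inj₂ (m , r′ , g) = closed (reach-closed closed Si k m r′) g

  module _ (i : Fin n) where

    closed-suc : ∀ {k} → Closed (reachWithin G k i) → Closed (reachWithin G (suc k) i)
    closed-suc {k} closed {m} r g = reach-step k i (reach-closed closed {i} (reach-refl k i) (suc k) m r) g

    closed-or-grows : ∀ k → Closed (reachWithin G k i) ⊎ k < countFin (reachWithin G k i)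
    closed-or-grows zero = inj₂ (countFin-witness (reachWithin G 0 i) (reach-refl 0 i))
    closed-or-grows (suc k) with closed-or-grows k
    ... | inj₁ closed = inj₁ (closed-suc {k} closed)
    ... | inj₂ k<size with countFin-⊂ (reachWithin G k i) (reachWithin G (suc k) i) (∨-introˡ _)
    ...   | inj₁ shrinks = inj₁ (closed-suc {k} (λ r g → shrinks (reach-step k i r g)))
    ...   | inj₂ grows   = inj₂ (≤-trans (s≤s k<size) grows)

    closed-at-n : Closed (sameComponent G i)
    closed-at-n with closed-or-grows n
    ... | inj₁ closed = closed
    ... | inj₂ n<size = contradiction (≤-trans n<size (countFin-≤ (reachWithin G n i))) (n≮n n)

  reach⇒sameComponent : ∀ k i j → reachWithin G k i j ≡ true → sameComponent G i j ≡ true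
  reach⇒sameComponent k i = reach-closed (closed-at-n i) {i} (reach-refl n i) k

  sameComponent-trans : ∀ i m j → sameComponent G i m ≡ true → sameComponent G m j ≡ true →
                        sameComponent G i j ≡ true
  sameComponent-trans i m j im = reach-closed (closed-at-n i) {m} im n j

  edge⇒sameComponent : ∀ i {j} → G i j ≡ true → sameComponent G i j ≡ true
  edge⇒sameComponent i = closed-at-n i {i} (reach-refl n i)

  last-edge : ∀ k i j → reachWithin G k i j ≡ true → i ≢ j →
              ∃ λ u → sameComponent G i u ≡ true × G u j ≡ true
  last-edge zero    i j r i≢j = contradiction (==F⇒≡ r) i≢j
  last-edge (suc k) i j r i≢j with reach-last k i j r
  ... | inj₁ r′           = last-edge k i j r′ i≢j
  ... | inj₂ (m , r′ , g) = m , reach⇒sameComponent k i m r′ , g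

  module _ (G-sym : Symmetric G) where

    reach-sym : ∀ k i j → reachWithin G k i j ≡ true → sameComponent G j i ≡ true
    reach-sym zero    i j r = subst (λ x → sameComponent G x i ≡ true) (==F⇒≡ r) (reach-refl n i)
    reach-sym (suc k) i j r with reach-last k i j r
    ... | inj₁ r′           = reach-sym k i j r′
    ... | inj₂ (m , r′ , g) =
      sameComponent-trans j m i (edge⇒sameComponent j (trans (G-sym j m) g)) (reach-sym k i m r′)

    sameComponent-sym : ∀ i j → sameComponent G i j ≡ true → sameComponent G j i ≡ true
    sameComponent-sym = reach-sym n

    -- The fallback i is never used: i lies in its own component.
    rep : Fin n → Fin n
    rep i = fromMaybe i (firstTrue (sameComponent G i))

    rep-sameComponent : ∀ i → sameComponent G i (rep i) ≡ true
    rep-sameComponent i with firstTrue (sameComponent G i) in e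
    ... | just r  = firstTrue-sound (sameComponent G i) e
    ... | nothing = reach-refl n i

    sameComponent⇒rep≡ : ∀ i j → sameComponent G i j ≡ true → rep i ≡ rep j
    sameComponent⇒rep≡ i j ij = begin
        rep i  ≡⟨ cong (fromMaybe i) first-i ⟩
        r      ≡⟨ cong (fromMaybe j) first-j ⟨
        rep j  ∎
      where
      open ≡-Reasoning
      same : ∀ k → sameComponent G i k ≡ sameComponent G j k
      same k = ⇔→≡ (mk⇔ (sameComponent-trans j i k (sameComponent-sym i j ij)) (sameComponent-trans i j k ij))
      first : ∃ λ r → firstTrue (sameComponent G i) ≡ just r
      first = firstTrue-complete (sameComponent G i) (reach-refl n i)
      r = proj₁ first
      first-i : firstTrue (sameComponent G i) ≡ just r
      first-i = proj₂ first
      first-j : firstTrue (sameComponent G j) ≡ just r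
      first-j = trans (sym (firstTrue-cong same)) first-i

    rep≡⇒sameComponent : ∀ i j → rep i ≡ rep j → sameComponent G i j ≡ true
    rep≡⇒sameComponent i j e = sameComponent-trans i (rep i) j (rep-sameComponent i)
      (sameComponent-sym j (rep i) (subst (λ x → sameComponent G j x ≡ true) (sym e) (rep-sameComponent j)))

    sameComponent≡rep==F : ∀ i j → sameComponent G i j ≡ (rep i ==F rep j)
    sameComponent≡rep==F i j =
      ⇔→≡ (mk⇔ (≡⇒==F ∘ sameComponent⇒rep≡ i j) (rep≡⇒sameComponent i j ∘ ==F⇒≡))

    edge⇒rep≡ : ∀ {i j} → G i j ≡ true → rep i ≡ rep j
    edge⇒rep≡ {i} {j} = sameComponent⇒rep≡ i j ∘ edge⇒sameComponent i

    rep-bicoloured : ∀ {φ} → Proper G φ → ∀ {i j} → rep i ≡ rep j → i ≢ j →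
                     ∃₂ λ u v → rep u ≡ rep i × rep v ≡ rep i × φ u ≢ φ v
    rep-bicoloured φ-proper {i} {j} e i≢j =
      let u , iu , g = last-edge n i j (rep≡⇒sameComponent i j e) i≢j
      in u , j , sym (sameComponent⇒rep≡ i u iu) , sym e , φ-proper u j g

-- Recolouring a snapshot class by class

χ-flip-sum : ∀ β x₁ x₀ y₁ y₀ →
  x₁ * χ ((β xor true) xor true) + x₀ * χ ((β xor true) xor false)
    + y₁ * χ ((β xor false) xor true) + y₀ * χ ((β xor false) xor false)
  ≡ (if β then x₁ + y₀ else x₀ + y₁)
χ-flip-sum true  x₁ x₀ y₁ y₀ = flipped x₁ x₀ y₁ y₀
  where
  flipped : ∀ x₁ x₀ y₁ y₀ → x₁ * 1 + x₀ * 0 + y₁ * 0 + y₀ * 1 ≡ x₁ + y₀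
  flipped = solve-∀
χ-flip-sum false x₁ x₀ y₁ y₀ = kept x₁ x₀ y₁ y₀
  where
  kept : ∀ x₁ x₀ y₁ y₀ → x₁ * 0 + x₀ * 1 + y₁ * 1 + y₀ * 0 ≡ x₀ + y₁
  kept = solve-∀

if-≤ᵇ-⊓ : ∀ u v → (if u ≤ᵇ v then u else v) ≡ u ⊓ v
if-≤ᵇ-⊓ u v with u ≤ᵇ v in e
... | true  = sym (m≤n⇒m⊓n≡m (≤ᵇ⇒≤ u v (≡⇒T e)))
... | false = sym (m≥n⇒m⊓n≡n (≰⇒≥ (λ u≤v → subst T e (≤⇒≤ᵇ u≤v))))

+≤1⇒⊓≡0 : ∀ m n → m + n ≤ 1 → m ⊓ n ≡ 0
+≤1⇒⊓≡0 zero    n       _        = refl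
+≤1⇒⊓≡0 (suc m) zero    _        = refl
+≤1⇒⊓≡0 (suc m) (suc n) (s≤s le) = contradiction (subst (_≤ 0) (+-suc m n) le) λ ()

-- x₁ + y₀ and x₀ + y₁ are the disagreements of the two colourings of a class with
-- colour classes of sizes x₁ + x₀ and y₁ + y₀, and x₁ y₁ + x₀ y₀ counts its monochromatic
-- pairs; the hypotheses say that a class with only one colour has at most one vertex.
⊓-≤-cross : ∀ x₁ x₀ y₁ y₀ → (x₁ + x₀ ≡ 0 → y₁ + y₀ ≤ 1) → (y₁ + y₀ ≡ 0 → x₁ + x₀ ≤ 1) →
            (x₁ + y₀) ⊓ (x₀ + y₁) ≤ x₁ * y₁ + x₀ * y₀
⊓-≤-cross zero     zero     y₁       y₀       one _ =
  ≤-reflexive (trans (⊓-comm y₀ y₁) (+≤1⇒⊓≡0 y₁ y₀ (one refl)))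
⊓-≤-cross zero     (suc x₀) y₁       y₀       _ _ = ≤-trans (m⊓n≤m y₀ _) (m≤m+n y₀ (x₀ * y₀))
⊓-≤-cross (suc x₁) x₀       y₁       (suc y₀) _ _ = begin
  (suc x₁ + suc y₀) ⊓ (x₀ + y₁)  ≤⟨ m⊓n≤n _ _ ⟩
  x₀ + y₁                        ≡⟨ +-comm x₀ y₁ ⟩
  y₁ + x₀                        ≤⟨ +-mono-≤ (m≤n*m y₁ (suc x₁)) (m≤m*n x₀ (suc y₀)) ⟩
  suc x₁ * y₁ + x₀ * suc y₀      ∎
  where open ≤-Reasoning
⊓-≤-cross (suc x₁) x₀       (suc y₁) zero     _ _ = begin
  (suc x₁ + 0) ⊓ (x₀ + suc y₁)   ≤⟨ m⊓n≤m _ _ ⟩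
  suc x₁ + 0                     ≡⟨ +-identityʳ (suc x₁) ⟩
  suc x₁                         ≤⟨ m≤m*n (suc x₁) (suc y₁) ⟩
  suc x₁ * suc y₁                ≤⟨ m≤m+n _ (x₀ * 0) ⟩
  suc x₁ * suc y₁ + x₀ * 0       ∎
  where open ≤-Reasoning
⊓-≤-cross (suc x₁) zero     zero     zero     _ _   = z≤n
⊓-≤-cross (suc x₁) (suc x₀) zero     zero     _ one =
  contradiction (+≤1⇒⊓≡0 (suc x₁) (suc x₀) (one refl)) λ ()

module ClassFlip {n m} (κ : Fin n → Fin m) (φ a : Fin n → Bool) where

  inClass : Fin m → Fin n → Bool
  inClass r j = r ==F κ j

  N : Fin m → Bool → Bool → ℕ
  N r = typeCount (inClass r) φ a

  x₁ x₀ y₁ y₀ : Fin m → ℕ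
  x₁ r = N r true  true
  x₀ r = N r true  false
  y₁ r = N r false true
  y₀ r = N r false false

  -- Keeping φ on class r disagrees with a on x₀ r + y₁ r vertices, flipping it on x₁ r + y₀ r.
  flips : Fin m → Bool
  flips r = x₁ r + y₀ r ≤ᵇ x₀ r + y₁ r

  ψ : Fin n → Bool
  ψ j = flips (κ j) xor φ j

  ψ-proper : ∀ {G : Graph n} → Proper G φ → (∀ {i j} → G i j ≡ true → κ i ≡ κ j) → Proper G ψ
  ψ-proper φ-proper same i j g ψi≡ψj = φ-proper i j g
    (xor-cancelˡ (flips (κ i)) (trans ψi≡ψj (cong (λ r → flips r xor φ j) (sym (same g)))))

  monoDegree : Fin n → ℕ
  monoDegree i = countFin (λ j → (κ i ==F κ j) ∧ (φ i xor φ j) ∧ not (a i xor a j))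

  disagreements monoPairs : Fin m → ℕ
  disagreements r = sumFin (λ j → if inClass r j then χ (ψ j xor a j) else 0)
  monoPairs     r = sumFin (λ i → if inClass r i then monoDegree i else 0)

  disagreements≡⊓ : ∀ r → disagreements r ≡ (x₁ r + y₀ r) ⊓ (x₀ r + y₁ r)
  disagreements≡⊓ r = begin
      disagreements r
    ≡⟨ sumFin-cong in-class ⟩
      sumFin (λ j → if inClass r j then h (φ j) (a j) else 0)
    ≡⟨ sumFin-if-byType (inClass r) φ a h ⟩
      x₁ r * h true true + x₀ r * h true false + y₁ r * h false true + y₀ r * h false false
    ≡⟨ χ-flip-sum (flips r) (x₁ r) (x₀ r) (y₁ r) (y₀ r) ⟩
      (if flips r then x₁ r + y₀ r else x₀ r + y₁ r)
    ≡⟨ if-≤ᵇ-⊓ (x₁ r + y₀ r) (x₀ r + y₁ r) ⟩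
      (x₁ r + y₀ r) ⊓ (x₀ r + y₁ r) ∎
    where
    open ≡-Reasoning
    h : Bool → Bool → ℕ
    h p q = χ ((flips r xor p) xor q)
    in-class : ∀ j → (if inClass r j then χ (ψ j xor a j) else 0)
                     ≡ (if inClass r j then h (φ j) (a j) else 0)
    in-class j with inClass r j in e
    ... | true  = cong (λ s → χ ((flips s xor φ j) xor a j)) (sym (==F⇒≡ e))
    ... | false = refl

  monoDegree-in-class : ∀ {r i} → r ≡ κ i → monoDegree i ≡ N r (not (φ i)) (a i)
  monoDegree-in-class {i = i} refl = countFin-cong λ j → begin
      (κ i ==F κ j) ∧ (φ i xor φ j) ∧ not (a i xor a j)
    ≡⟨ ∧-assoc (κ i ==F κ j) _ _ ⟨
      ((κ i ==F κ j) ∧ (φ i xor φ j)) ∧ not (a i xor a j)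
    ≡⟨ cong₂ (λ u v → ((κ i ==F κ j) ∧ u) ∧ v)
             (cong (_xor φ j) (sym (not-involutive (φ i)))) (not-distribˡ-xor (a i) (a j)) ⟩
      ((κ i ==F κ j) ∧ (φ j is not (φ i))) ∧ (a j is a i) ∎
    where open ≡-Reasoning

  monoPairs≡ : ∀ r → monoPairs r ≡ 2 * (x₁ r * y₁ r + x₀ r * y₀ r)
  monoPairs≡ r = begin
      monoPairs r
    ≡⟨ sumFin-cong in-class ⟩
      sumFin (λ i → if inClass r i then N r (not (φ i)) (a i) else 0)
    ≡⟨ sumFin-if-byType (inClass r) φ a (λ p q → N r (not p) q) ⟩
      x₁ r * y₁ r + x₀ r * y₀ r + y₁ r * x₁ r + y₀ r * x₀ r
    ≡⟨ double (x₁ r) (x₀ r) (y₁ r) (y₀ r) ⟩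
      2 * (x₁ r * y₁ r + x₀ r * y₀ r) ∎
    where
    open ≡-Reasoning
    in-class : ∀ i → (if inClass r i then monoDegree i else 0)
                     ≡ (if inClass r i then N r (not (φ i)) (a i) else 0)
    in-class i with inClass r i in e
    ... | true  = monoDegree-in-class (==F⇒≡ e)
    ... | false = refl
    double : ∀ x₁ x₀ y₁ y₀ → x₁ * y₁ + x₀ * y₀ + y₁ * x₁ + y₀ * x₀ ≡ 2 * (x₁ * y₁ + x₀ * y₀)
    double = solve-∀

  module _ (bicoloured : ∀ {i j} → κ i ≡ κ j → i ≢ j → ∃₂ λ u v → κ u ≡ κ i × κ v ≡ κ i × φ u ≢ φ v)
    where

    monochromatic⇒≤1 : ∀ r b → (∀ {j} → inClass r j ≡ true → φ j ≡ b) → countFin (inClass r) ≤ 1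
    monochromatic⇒≤1 r b mono = countFin-≤1 (inClass r) same
      where
      same : ∀ {i j} → inClass r i ≡ true → inClass r j ≡ true → i ≡ j
      same {i} {j} ri rj with i ≟ j
      ... | yes i≡j = i≡j
      ... | no  i≢j =
        let u , v , κu , κv , φu≢φv = bicoloured (trans (sym (==F⇒≡ ri)) (==F⇒≡ rj)) i≢j
            member : ∀ {w} → κ w ≡ κ i → inClass r w ≡ true
            member κw = ≡⇒==F (trans (==F⇒≡ ri) (sym κw))
        in contradiction (trans (mono (member κu)) (sym (mono (member κv)))) φu≢φv

    empty-side⇒other-side≤1 : ∀ r s → N r s true + N r s false ≡ 0 →
                              N r (not s) true + N r (not s) false ≤ 1
    empty-side⇒other-side≤1 r s empty = begin
        N r (not s) true + N r (not s) false
      ≡⟨ countFin-split (λ j → inClass r j ∧ (φ j is not s)) a ⟨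
        countFin (λ j → inClass r j ∧ (φ j is not s))
      ≤⟨ countFin-mono {q = inClass r} (λ {j} → ∧-conicalˡ (inClass r j) _) ⟩
        countFin (inClass r)
      ≤⟨ monochromatic⇒≤1 r (not s) (λ {j} rj → is-not (φ j) s (λ φj → side-s-empty (∧-intro rj φj))) ⟩
        1 ∎
      where
      open ≤-Reasoning
      side-s-empty : ∀ {j} → (inClass r j ∧ (φ j is s)) ≡ true → ⊥
      side-s-empty = countFin≡0⇒false (λ j → inClass r j ∧ (φ j is s))
                       (trans (countFin-split (λ j → inClass r j ∧ (φ j is s)) a) empty)

    2*disagreements≤monoPairs : ∀ r → 2 * disagreements r ≤ monoPairs r
    2*disagreements≤monoPairs r = begin
        2 * disagreements r
      ≡⟨ cong (2 *_) (disagreements≡⊓ r) ⟩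
        2 * ((x₁ r + y₀ r) ⊓ (x₀ r + y₁ r))
      ≤⟨ *-monoʳ-≤ 2 (⊓-≤-cross (x₁ r) (x₀ r) (y₁ r) (y₀ r)
                       (empty-side⇒other-side≤1 r true) (empty-side⇒other-side≤1 r false)) ⟩
        2 * (x₁ r * y₁ r + x₀ r * y₀ r)
      ≡⟨ monoPairs≡ r ⟨
        monoPairs r ∎
      where open ≤-Reasoning

    2*disagreements≤∑monoDegree : 2 * countFin (λ j → ψ j xor a j) ≤ sumFin monoDegree
    2*disagreements≤∑monoDegree = begin
        2 * countFin (λ j → ψ j xor a j)
      ≡⟨ cong (2 *_) (countFin≡sumFin (λ j → ψ j xor a j)) ⟩
        2 * sumFin (λ j → χ (ψ j xor a j))
      ≡⟨ cong (2 *_) (sumFin-fibres κ (λ j → χ (ψ j xor a j))) ⟩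
        2 * sumFin disagreements
      ≡⟨ sumFin-*ˡ 2 disagreements ⟩
        sumFin (λ r → 2 * disagreements r)
      ≤⟨ sumFin-mono 2*disagreements≤monoPairs ⟩
        sumFin monoPairs
      ≡⟨ sumFin-fibres κ monoDegree ⟨
        sumFin monoDegree ∎
      where open ≤-Reasoning

orderedPairs≤2*unorderedPairs : ∀ {k} (Q : Fin k → Fin k → Bool) →
  (∀ {i j} → Q i j ≡ true → Q j i ≡ true) → (∀ {i j} → Q i j ≡ true → i ≢ j) →
  sumFin (λ i → countFin (Q i)) ≤ 2 * sumFin (λ i → countFin (λ j → (toℕ i <ᵇ toℕ j) ∧ Q i j))
orderedPairs≤2*unorderedPairs {k} Q Q-sym Q-irrefl = begin
    sumFin (λ i → countFin (Q i))
  ≤⟨ sumFin-mono (λ i → ≤-trans (countFin-mono {q = λ j → before i j ∨ after i j} (split i))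
                                 (countFin-∨ (before i) (after i))) ⟩
    sumFin (λ i → countFin (before i) + countFin (after i))
  ≡⟨ sumFin-+ (λ i → countFin (before i)) (λ i → countFin (after i)) ⟩
    U + sumFin (λ i → countFin (after i))
  ≡⟨ cong (U +_) (countFin-swap after) ⟩
    U + U
  ≡⟨ cong (U +_) (+-identityʳ U) ⟨
    2 * U ∎
  where
  open ≤-Reasoning
  before after : Fin k → Fin k → Bool
  before i j = (toℕ i <ᵇ toℕ j) ∧ Q i j
  after  i j = (toℕ j <ᵇ toℕ i) ∧ Q j i
  U = sumFin (λ i → countFin (before i))
  split : ∀ i {j} → Q i j ≡ true → (before i j ∨ after i j) ≡ true
  split i {j} q with <-cmp (toℕ i) (toℕ j)
  ... | tri< i<j _ _ = ∨-introˡ (after i j) (∧-intro (T⇒≡ (<⇒<ᵇ i<j)) q)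
  ... | tri≈ _ i≡j _ = contradiction (toℕ-injective i≡j) (Q-irrefl q)
  ... | tri> _ _ j<i = ∨-introʳ (before i j) (∧-intro (T⇒≡ (<⇒<ᵇ j<i)) (Q-sym q))

monoSnapshot : ∀ {n} → Graph n → (Fin n → Bool) → (Fin n → Bool) → ℕ
monoSnapshot G φ a = sumFin λ i → countFin λ j →
  (toℕ i <ᵇ toℕ j) ∧ sameComponent G i j ∧ (φ i xor φ j) ∧ not (a i xor a j)

snapshot-recolouring : ∀ {n} (G : Graph n) → Symmetric G → ∀ {φ} → Proper G φ → (a : Fin n → Bool) →
  Σ (Fin n → Bool) λ ψ → Proper G ψ × countFin (λ v → ψ v xor a v) ≤ monoSnapshot G φ a
snapshot-recolouring {n} G G-sym {φ} φ-proper a =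
  ψ , ψ-proper φ-proper (edge⇒rep≡ G-sym) , *-cancelˡ-≤ 2 (begin
      2 * countFin (λ v → ψ v xor a v)
    ≤⟨ 2*disagreements≤∑monoDegree (rep-bicoloured G-sym φ-proper) ⟩
      sumFin (λ i → countFin (λ j → (rep G-sym i ==F rep G-sym j) ∧ mono i j))
    ≡⟨ sumFin-cong (λ i → countFin-cong (λ j → cong (_∧ mono i j) (sameComponent≡rep==F G-sym i j))) ⟨
      sumFin (λ i → countFin (Q i))
    ≤⟨ orderedPairs≤2*unorderedPairs Q Q-sym Q-irrefl ⟩
      2 * monoSnapshot G φ a ∎)
  where
  open Reachability G
  open ClassFlip (rep G-sym) φ a
  open ≤-Reasoning
  mono Q : Fin n → Fin n → Bool
  mono i j = (φ i xor φ j) ∧ not (a i xor a j)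
  Q i j = sameComponent G i j ∧ mono i j
  Q-sym : ∀ {i j} → Q i j ≡ true → Q j i ≡ true
  Q-sym {i} {j} q = ∧-intro (sameComponent-sym G-sym i j (∧-conicalˡ _ (mono i j) q))
    (trans (cong₂ (λ u v → u ∧ not v) (xor-comm (φ j) (φ i)) (xor-comm (a j) (a i)))
           (∧-conicalʳ (sameComponent G i j) _ q))
  Q-irrefl : ∀ {i j} → Q i j ≡ true → i ≢ j
  Q-irrefl {i} q refl = contradiction
    (trans (sym (xor-same (φ i))) (∧-conicalˡ (φ i xor φ i) _ (∧-conicalʳ (sameComponent G i i) _ q))) λ ()

-- Alternating colourings in time

odd : ℕ → Bool
odd zero    = false
odd (suc k) = not (odd k)

alternate : ∀ {n T} → (Fin T → Fin n → Bool) → Fin T → Fin n → Bool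
alternate ψ t v = odd (toℕ t) xor ψ t v

xor-proper : ∀ {n} {G : Graph n} {ψ} b → Proper G ψ → Proper G (λ v → b xor ψ v)
xor-proper b ψ-proper i j g = ψ-proper i j g ∘ xor-cancelˡ b

next : ∀ {T} → Fin T → Fin T → Bool
next s t = toℕ t ≡ᵇ suc (toℕ s)

next-sound : ∀ {T} (s t : Fin T) → next s t ≡ true → toℕ t ≡ suc (toℕ s)
next-sound s t e = ≡ᵇ⇒≡ (toℕ t) (suc (toℕ s)) (≡⇒T e)

alternate-step : ∀ {n T} (ψ : Fin T → Fin n → Bool) {s t} v → next s t ≡ true →
                 (alternate ψ s v xor alternate ψ t v) ≡ not (ψ s v xor ψ t v)
alternate-step ψ {s} {t} v e =
  trans (cong (λ k → (odd (toℕ s) xor ψ s v) xor (odd k xor ψ t v)) (next-sound s t e))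
        (xor-alternate (odd (toℕ s)) (ψ s v) (ψ t v))

steps-from-≤ : ∀ {T} (e : Fin T → Bool) → sumFin (λ s → countFin (λ t → e s ∧ next s t)) ≤ countFin e
steps-from-≤ e = begin
    sumFin (λ s → countFin (λ t → e s ∧ next s t))
  ≤⟨ sumFin-mono (λ s → countFin-guard (e s) (next s) (one s)) ⟩
    sumFin (χ ∘ e)
  ≡⟨ countFin≡sumFin e ⟨
    countFin e ∎
  where
  open ≤-Reasoning
  one : ∀ s → countFin (next s) ≤ 1
  one s = countFin-≤1 (next s) λ {t} {t′} e e′ →
    toℕ-injective (trans (next-sound s t e) (sym (next-sound s t′ e′)))

steps-into-≤ : ∀ {T} (e : Fin T → Bool) → sumFin (λ s → countFin (λ t → e t ∧ next s t)) ≤ countFin e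
steps-into-≤ e = begin
    sumFin (λ s → countFin (λ t → e t ∧ next s t))
  ≡⟨ countFin-swap (λ s t → e t ∧ next s t) ⟩
    sumFin (λ t → countFin (λ s → e t ∧ next s t))
  ≤⟨ sumFin-mono (λ t → countFin-guard (e t) (λ s → next s t) (one t)) ⟩
    sumFin (χ ∘ e)
  ≡⟨ countFin≡sumFin e ⟨
    countFin e ∎
  where
  open ≤-Reasoning
  one : ∀ t → countFin (λ s → next s t) ≤ 1
  one t = countFin-≤1 (λ s → next s t) λ {s} {s′} e e′ →
    toℕ-injective (suc-injective (trans (sym (next-sound s t e)) (next-sound s′ t e′)))

step-changes-≤ : ∀ {T} (Δ μ : Fin T → Fin T → Bool) (e : Fin T → Bool) →
  (∀ {s t} → next s t ≡ true → Δ s t ≡ true → (e s ∨ μ s t ∨ e t) ≡ true) →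
  sumFin (λ s → countFin (λ t → next s t ∧ Δ s t))
    ≤ countFin e + sumFin (λ s → countFin (λ t → next s t ∧ μ s t)) + countFin e
step-changes-≤ {T} Δ μ e charge = begin
    sumFin (λ s → countFin (λ t → next s t ∧ Δ s t))
  ≤⟨ sumFin-mono (λ s → countFin-∨₃ {q = from s} {step s} {into s} (charged s)) ⟩
    sumFin (λ s → countFin (from s) + countFin (step s) + countFin (into s))
  ≡⟨ sumFin-+₃ (countFin ∘ from) (countFin ∘ step) (countFin ∘ into) ⟩
    sumFin (countFin ∘ from) + sumFin (countFin ∘ step) + sumFin (countFin ∘ into)
  ≤⟨ +-mono-≤ (+-monoˡ-≤ (sumFin (countFin ∘ step)) (steps-from-≤ e)) (steps-into-≤ e) ⟩
    countFin e + sumFin (countFin ∘ step) + countFin e ∎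
  where
  open ≤-Reasoning
  from step into : Fin T → Fin T → Bool
  from s t = e s ∧ next s t
  step s t = next s t ∧ μ s t
  into s t = e t ∧ next s t
  charged : ∀ s {t} → (next s t ∧ Δ s t) ≡ true → (from s t ∨ step s t ∨ into s t) ≡ true
  charged s {t} h with next s t in nx
  charged s {t} h  | true rewrite ∧-identityʳ (e s) | ∧-identityʳ (e t) = charge nx h
  charged s {t} () | false

Cost-alternate-≤ : ∀ {n T} (ψ : Fin T → Fin n → Bool) (A : Fin n → Fin T → Bool) →
  let D = sumFin (λ t → countFin (λ v → ψ t v xor A v t)) in
  Cost (alternate ψ) ≤ D + monoC A + D
Cost-alternate-≤ {n} {T} ψ A = begin
    Cost (alternate ψ)
  ≤⟨ sumFin-mono (λ v → step-changes-≤ _ (μ v) (e v) (charge v)) ⟩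
    sumFin (λ v → countFin (e v) + M v + countFin (e v))
  ≡⟨ sumFin-+₃ (λ v → countFin (e v)) M (λ v → countFin (e v)) ⟩
    sumFin (λ v → countFin (e v)) + monoC A + sumFin (λ v → countFin (e v))
  ≡⟨ cong (λ z → z + monoC A + z) (countFin-swap e) ⟩
    D + monoC A + D ∎
  where
  open ≤-Reasoning
  D = sumFin (λ t → countFin (λ v → ψ t v xor A v t))
  e : Fin n → Fin T → Bool
  e v s = ψ s v xor A v s
  μ : Fin n → Fin T → Fin T → Bool
  μ v s t = not (A v s xor A v t)
  M : Fin n → ℕ
  M v = sumFin (λ s → countFin (λ t → next s t ∧ μ v s t))
  charge : ∀ v {s t} → next s t ≡ true → (alternate ψ s v xor alternate ψ t v) ≡ true →
           (e v s ∨ μ v s t ∨ e v t) ≡ true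
  charge v {s} {t} nx changed =
    unchanged-charge (ψ s v) (ψ t v) (A v s) (A v t) (trans (sym (alternate-step ψ v nx)) changed)

d+m+d≤2*[m+s] : ∀ {d s} m → d ≤ s → d + m + d ≤ 2 * (m + s)
d+m+d≤2*[m+s] {d} {s} m d≤s = begin
  d + m + d      ≤⟨ +-mono-≤ (+-monoˡ-≤ m d≤s) d≤s ⟩
  s + m + s      ≤⟨ m≤m+n (s + m + s) m ⟩
  s + m + s + m  ≡⟨ twice m s ⟩
  2 * (m + s)    ∎
  where
  open ≤-Reasoning
  twice : ∀ m s → s + m + s + m ≡ 2 * (m + s)
  twice = solve-∀

lemma3 : ∀ {n T : ℕ} (G : TemporalGraph n T)
           → (∀ (t : Fin T) → Symmetric (G t))
           → (bip : ∀ (t : Fin T) → Bipartite (G t))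
           → (A : Fin n → Fin T → Bool) (c : ℕ)
           → monoEdges G bip A ≤ c
           → Σ (Fin T → Fin n → Bool)
               (λ Ψ → IsTemporalColouring G Ψ × Cost Ψ ≤ 2 * c)
lemma3 {n} {T} G G-sym bip A c monoEdges≤c = alternate ψ , Ψ-proper , Cost≤2c
  where
  recoloured : ∀ t → Σ (Fin n → Bool) λ ψ → Proper (G t) ψ ×
               countFin (λ v → ψ v xor A v t) ≤ monoSnapshot (G t) (proj₁ (bip t)) (λ v → A v t)
  recoloured t = snapshot-recolouring (G t) (G-sym t) (proj₂ (bip t)) (λ v → A v t)

  ψ : Fin T → Fin n → Bool
  ψ t = proj₁ (recoloured t)

  Ψ-proper : IsTemporalColouring G (alternate ψ)
  Ψ-proper t = xor-proper (odd (toℕ t)) (proj₁ (proj₂ (recoloured t)))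

  Cost≤2c : Cost (alternate ψ) ≤ 2 * c
  Cost≤2c = ≤-trans (Cost-alternate-≤ ψ A)
    (≤-trans (d+m+d≤2*[m+s] (monoC A) (sumFin-mono (λ t → proj₂ (proj₂ (recoloured t)))))
             (*-monoʳ-≤ 2 monoEdges≤c))
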